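{- Let $G=(V,E)$ be a graph satisfying the standing assumptions and let $u,v\in V$. (1) If $(u,v)\in E$ and $\lambda(u)\prec\lambda(v)$, then $\tau(v)=1$. (2) If $(u,v)\in E$, $\lambda(u)=\lambda(v)$ and $\tau(u)=1$, then $\tau(v)=1$.
   Context: Standing assumptions: $\Sigma$ is a finite alphabet with a total order $\preceq$; $G=(V,E)$ is finite, $E\subseteq V\times V\times\Sigma$, every node has an incoming edge, all edges entering a node $u$ have the same label $\lambda(u)$ (edges are written $(u,v)$), and $G$ is deterministic. An occurrence of $\alpha\in\Sigma^\omega$ starting at $u$ is a sequence $(u_i)_{i\ge1}$ with $u_1=u$, $(u_{i+1},u_i)\in E$, $\lambda(u_i)=\alpha[i]$; $\min_u$ is the lexicographically smallest string in $\Sigma^\omega$ with an occurrence starting at $u$. For $\alpha=a\alpha'$ ($a\in\Sigma$): $\tau(\alpha)=1$ if $\alpha'\prec\alpha$, $2$ if $\alpha'=\alpha$, $3$ if $\alpha\prec\alpha'$; $\tau(u):=\tau(\min_u)$. -}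

module Defs where

open import Data.Nat using (ℕ; zero; suc; _<_)
open import Data.Fin using (Fin)
open import Data.Fin as F using ()
open import Data.Bool using (Bool; true)
open import Data.Product using (Σ; ∃; _×_; _,_)
open import Relation.Binary.PropositionalEquality using (_≡_)
open import Relation.Nullary using (¬_)

-- The alphabet Σ is a finite totally ordered set, represented (up to
-- order isomorphism) as Fin σ with its usual order.
Alphabet : ℕ → Set
Alphabet σ = Fin σ

_≺ₗ_ : ∀ {σ} → Fin σ → Fin σ → Set
a ≺ₗ b = a F.< b

-- Infinite strings Σ^ω, 0-indexed: α i is the (i+1)-th letter α[i+1].
Str : ℕ → Set
Str σ = ℕ → Fin σ

tail : ∀ {σ} → Str σ → Str σ
tail α i = α (suc i)

_≈ₛ_ : ∀ {σ} → Str σ → Str σ → Set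
α ≈ₛ β = ∀ i → α i ≡ β i

_≺ₛ_ : ∀ {σ} → Str σ → Str σ → Set
α ≺ₛ β = Σ ℕ λ k → (∀ i → i < k → α i ≡ β i) × (α k ≺ₗ β k)

-- Since all edges entering v carry the label λ(v), an edge (u,v,a) ∈ E
-- is determined by (u,v) (with a = λ v); E is the edge relation.
record Graph (σ n : ℕ) : Set where
  field
    E        : Fin n → Fin n → Bool
    label    : Fin n → Fin σ
    incoming : ∀ v → ∃ λ u → E u v ≡ true
    determ   : ∀ u v w → E u v ≡ true → E u w ≡ true →
               label v ≡ label w → v ≡ w

module _ {σ n : ℕ} (G : Graph σ n) where
  open Graph G

  -- an occurrence of α starting at u: u_1 = u, (u_{i+1}, u_i) ∈ E,
  -- λ(u_i) = α[i]   (0-indexed here)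
  Occurrence : Fin n → Str σ → Set
  Occurrence u α =
    Σ (ℕ → Fin n) λ us →
      (us 0 ≡ u) ×
      (∀ i → E (us (suc i)) (us i) ≡ true) ×
      (∀ i → label (us i) ≡ α i)

  IsMin : Fin n → Str σ → Set
  IsMin u α = Occurrence u α × (∀ β → Occurrence u β → ¬ (β ≺ₛ α))

data τStr {σ : ℕ} (α : Str σ) : ℕ → Set where
  τ1 : tail α ≺ₛ α → τStr α 1
  τ2 : tail α ≈ₛ α → τStr α 2
  τ3 : α ≺ₛ tail α → τStr α 3

τNode : ∀ {σ n} → Graph σ n → Fin n → ℕ → Set
τNode G u t = Σ _ λ α → IsMin G u α × τStr α t

-- The minimum min_v is built letter by letter through frontiers: F₀ = {v}
-- and F_{k+1} is the set of predecessors of F_k with the least label. The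
-- frontiers evolve deterministically in the finite set of subsets of V, so
-- a pigeonhole argument threads one infinite path through all of them; its
-- labels spell min_v.
-- Part (1): the second letter of min_v is at most λ(u) < λ(v). Part (2):
-- with a = α[1], τ(α) = 1 iff tail α ≺ a^ω; from min_u ≺ a^ω we get
-- a·min_u ≺ a^ω, and minimality of min_v gives min_v ≺ a^ω.
module Submission where

open import Defs
open import Data.Nat as ℕ using (ℕ; zero; suc; _+_; _*_; _∸_; _^_; z≤n; s≤s)
import Data.Nat.Properties as ℕP
open import Data.Fin as F using (Fin; toℕ; combine; funToFin; finToFun)
open import Data.Fin.Patterns using (0F; 1F)
import Data.Fin.Properties as FP
open import Data.Bool using (true; if_then_else_)
import Data.Bool.Properties as BoolP
open import Data.List using (List; filter; allFin)
import Data.List.Extrema as Extrema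
open import Data.List.Relation.Unary.All as All using ()
open import Data.List.Relation.Unary.All.Properties using (all-filter)
open import Data.List.Membership.Propositional.Properties using (∈-filter⁺; ∈-allFin)
open import Data.Product using (Σ; ∃; ∃₂; _×_; _,_; proj₁; proj₂)
open import Data.Empty using (⊥)
open import Data.Sum using (_⊎_; inj₁; inj₂)
open import Function using (_∘_; const; case_of_)
open import Relation.Binary.PropositionalEquality using (_≡_; refl; sym; trans; cong; subst)
open import Relation.Binary.Definitions using (tri<; tri≈; tri>)
open import Relation.Nullary using (¬_; Dec; yes; no; does; contradiction)
open import Relation.Nullary.Decidable using (_×-dec_; _→-dec_)
open import Relation.Unary using (Pred; Decidable)
open import Level using (_⊔_)

_∷ₛ_ : ∀ {a} {A : Set a} → A → (ℕ → A) → ℕ → A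
(x ∷ₛ xs) zero    = x
(x ∷ₛ xs) (suc i) = xs i

module _ {σ : ℕ} where

  ≺ₛ-trans : {α β γ : Str σ} → α ≺ₛ β → β ≺ₛ γ → α ≺ₛ γ
  ≺ₛ-trans {α} {γ = γ} (j , α=β , α<β) (k , β=γ , β<γ) with ℕP.<-cmp j k
  ... | tri< j<k _ _ = j , (λ i i<j → trans (α=β i i<j) (β=γ i (ℕP.<-trans i<j j<k)))
                         , subst (α j F.<_) (β=γ j j<k) α<β
  ... | tri≈ _ refl _ = j , (λ i i<j → trans (α=β i i<j) (β=γ i i<j))
                          , FP.<-trans α<β β<γ
  ... | tri> _ _ k<j = k , (λ i i<k → trans (α=β i (ℕP.<-trans i<k k<j)) (β=γ i i<k))
                         , subst (F._< γ k) (sym (α=β k k<j)) β<γ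

  agree-or-≺ₛ : ∀ (α β : Str σ) k →
                (∀ i → i ℕ.< k → α i ≡ β i) ⊎ (α ≺ₛ β ⊎ β ≺ₛ α)
  agree-or-≺ₛ α β zero = inj₁ λ _ ()
  agree-or-≺ₛ α β (suc k) with agree-or-≺ₛ α β k
  ... | inj₂ differ = inj₂ differ
  ... | inj₁ agree with FP.<-cmp (α k) (β k)
  ...   | tri< α<β _ _  = inj₂ (inj₁ (k , agree , α<β))
  ...   | tri> _ _ β<α  = inj₂ (inj₂ (k , (λ i i<k → sym (agree i i<k)) , β<α))
  ...   | tri≈ _ α=β _ = inj₁ λ i i<k+1 →
    case ℕP.m≤n⇒m<n∨m≡n (ℕP.≤-pred i<k+1) of λ where
      (inj₁ i<k)  → agree i i<k
      (inj₂ refl) → α=β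

  ≮ₛ-≺ₛ-trans : {α β γ : Str σ} → ¬ (β ≺ₛ α) → β ≺ₛ γ → α ≺ₛ γ
  ≮ₛ-≺ₛ-trans {α} {β} {γ} β≮α (k , β=γ , β<γ) with agree-or-≺ₛ α β (suc k)
  ... | inj₂ (inj₁ α≺β) = ≺ₛ-trans α≺β (k , β=γ , β<γ)
  ... | inj₂ (inj₂ β≺α) = contradiction β≺α β≮α
  ... | inj₁ agree = k , (λ i i<k → trans (agree i (ℕP.m<n⇒m<1+n i<k)) (β=γ i i<k))
                       , subst (F._< γ k) (sym (agree k ℕP.≤-refl)) β<γ

  module _ {α : Str σ} {a : Fin σ} (α₀ : α 0 ≡ a) where

    tail≺⇒tail≺const : tail α ≺ₛ α → tail α ≺ₛ const a
    tail≺⇒tail≺const (k , steady , drop) =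
      k , (λ i i<k → constant (suc i) i<k) , subst (α (suc k) F.<_) (constant k ℕP.≤-refl) drop
      where
        constant : ∀ i → i ℕ.≤ k → α i ≡ a
        constant zero    _      = α₀
        constant (suc i) i+1≤k = trans (steady i i+1≤k) (constant i (ℕP.<⇒≤ i+1≤k))

    tail≺const⇒tail≺ : tail α ≺ₛ const a → tail α ≺ₛ α
    tail≺const⇒tail≺ (k , steady , drop) =
      k , (λ i i<k → trans (steady i i<k) (sym (constant i (ℕP.<⇒≤ i<k))))
        , subst (α (suc k) F.<_) (sym (constant k ℕP.≤-refl)) drop
      where
        constant : ∀ i → i ℕ.≤ k → α i ≡ a
        constant zero    _      = α₀
        constant (suc i) i+1≤k = steady i i+1≤k

    ≺const⇒tail≺const : α ≺ₛ const a → tail α ≺ₛ const a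
    ≺const⇒tail≺const (zero  , _ , drop) = contradiction drop (FP.<-irrefl α₀)
    ≺const⇒tail≺const (suc k , steady , drop) = k , (λ i i<k → steady (suc i) (s≤s i<k)) , drop

    tail≺const⇒≺const : tail α ≺ₛ const a → α ≺ₛ const a
    tail≺const⇒≺const (k , steady , drop) =
      suc k , (λ { zero _ → α₀ ; (suc i) (s≤s i<k) → steady i i<k }) , drop

-- Subsets of Fin n are coded in Fin (2 ^ n), so that the pigeonhole principle applies to them.
SubsetCode : ℕ → Set
SubsetCode n = Fin (2 ^ n)

_∈ᶜ_ : ∀ {n} → Fin n → SubsetCode n → Set
x ∈ᶜ c = finToFun c x ≡ 1F

_∈ᶜ?_ : ∀ {n} (x : Fin n) (c : SubsetCode n) → Dec (x ∈ᶜ c)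
x ∈ᶜ? c = finToFun c x FP.≟ 1F

module _ {n p} {P : Pred (Fin n) p} (P? : Decidable P) where

  indicator : Fin n → Fin 2
  indicator x = if does (P? x) then 1F else 0F

  ⟦_⟧ : SubsetCode n
  ⟦_⟧ = funToFin indicator

  ∈⟦⟧⁺ : ∀ {x} → P x → x ∈ᶜ ⟦_⟧
  ∈⟦⟧⁺ {x} Px = trans (FP.finToFun-funToFin indicator x) indicator≡1
    where
      indicator≡1 : indicator x ≡ 1F
      indicator≡1 with P? x
      ... | yes _  = refl
      ... | no ¬Px = contradiction Px ¬Px

  ∈⟦⟧⁻ : ∀ {x} → x ∈ᶜ ⟦_⟧ → P x
  ∈⟦⟧⁻ {x} x∈ = fromIndicator (trans (sym (FP.finToFun-funToFin indicator x)) x∈)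
    where
      fromIndicator : indicator x ≡ 1F → P x
      fromIndicator with P? x
      ... | yes Px = λ _ → Px
      ... | no _   = λ ()

∃-argmin : ∀ {n σ p} (f : Fin n → Fin σ) {P : Pred (Fin n) p} → Decidable P →
           ∀ {x} → P x → ∃ λ y → P y × (∀ z → P z → f y F.≤ f z)
∃-argmin {n} {σ} f P? {x} Px =
  argmin f x xs ,
  argmin-all f Px (all-filter P? (allFin n)) ,
  λ z Pz → All.lookup (f[argmin]≤f[xs] x xs) (∈-filter⁺ P? (∈-allFin z) Pz)
  where
    open Extrema (FP.≤-totalOrder σ)
    xs : List (Fin n)
    xs = filter P? (allFin n)

module InfiniteDescent
  {m n a b} (next : Fin m → Fin m) (Mem : Fin m → Fin n → Set a) (Edge : Fin n → Fin n → Set b)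
  (down : Fin m → Fin n → Fin n)
  (down-spec : ∀ {c x} → Mem (next c) x → Mem c (down c x) × Edge x (down c x))
  (c₀ : Fin m)
  where

  state : ℕ → Fin m
  state zero    = c₀
  state (suc k) = next (state k)

  descend : ℕ → ℕ → Fin n → Fin n
  descend h zero    x = x
  descend h (suc t) x = down (state h) (descend (suc h) t x)

  descend-mem : ∀ h t {x} → Mem (state (h + t)) x → Mem (state h) (descend h t x)
  descend-mem h zero    {x} x∈ = subst (λ k → Mem (state k) x) (ℕP.+-identityʳ h) x∈
  descend-mem h (suc t) {x} x∈ =
    proj₁ (down-spec (descend-mem (suc h) t (subst (λ k → Mem (state k) x) (ℕP.+-suc h t) x∈)))

  InfinitePath : Set (a ⊔ b)
  InfinitePath = ∃ λ (us : ℕ → Fin n) → ∀ k → Mem (state k) (us k) × Edge (us (suc k)) (us k)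

  module FromTop {K top} (top-mem : Mem (state K) top) where

    path : ℕ → Fin n
    path t = descend t (K ∸ t) top

    path-mem : ∀ {t} → t ℕ.≤ K → Mem (state t) (path t)
    path-mem {t} t≤K =
      descend-mem t (K ∸ t) (subst (λ k → Mem (state k) top) (sym (ℕP.m+[n∸m]≡n t≤K)) top-mem)

    path-edge : ∀ {t} → t ℕ.< K → Edge (path (suc t)) (path t)
    path-edge {t} t<K rewrite ℕP.+-∸-assoc 1 t<K = proj₂ (down-spec (path-mem t<K))

    -- Once (state, path) repeats, the levels i, …, j - 1 can be traversed periodically forever.
    periodic : ∀ {i j} → i ℕ.< j → j ℕ.≤ K →
               state i ≡ state j → path i ≡ path j → InfinitePath
    periodic {i} {j} i<j j≤K state-i≡state-j path-i≡path-j = us , λ k → us-mem k , us-edge k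
      where
        wrap : ℕ → ℕ
        wrap r with suc r ℕ.≟ j
        ... | yes _ = i
        ... | no _  = suc r

        level : ℕ → ℕ
        level zero    = zero
        level (suc k) = wrap (level k)

        level-spec : ∀ k → level k ℕ.< j × state (level k) ≡ state k
        level-spec zero = ℕP.≤-<-trans z≤n i<j , refl
        level-spec (suc k) with level-spec k
        ... | r<j , eq with suc (level k) ℕ.≟ j
        ...   | yes r+1≡j =
          i<j , trans state-i≡state-j (trans (cong state (sym r+1≡j)) (cong next eq))
        ...   | no r+1≢j  = ℕP.≤∧≢⇒< r<j r+1≢j , cong next eq

        wrap-edge : ∀ {r} → r ℕ.< j → Edge (path (wrap r)) (path r)
        wrap-edge {r} r<j with suc r ℕ.≟ j
        ... | yes r+1≡j = subst (λ x → Edge x (path r)) (trans (cong path r+1≡j) (sym path-i≡path-j))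
                            (path-edge (ℕP.<-≤-trans r<j j≤K))
        ... | no _      = path-edge (ℕP.<-≤-trans r<j j≤K)

        us : ℕ → Fin n
        us k = path (level k)

        us-mem : ∀ k → Mem (state k) (us k)
        us-mem k = subst (λ c → Mem c (us k)) (proj₂ (level-spec k))
                     (path-mem (ℕP.<⇒≤ (ℕP.<-≤-trans (proj₁ (level-spec k)) j≤K)))

        us-edge : ∀ k → Edge (us (suc k)) (us k)
        us-edge k = wrap-edge (proj₁ (level-spec k))

  infinite-descent : (∀ k → ∃ (Mem (state k))) → InfinitePath
  infinite-descent nonempty = from-repeat (FP.pigeonhole (ℕP.n<1+n (m * n)) code)
    where
      open FromTop {K = m * n} (proj₂ (nonempty (m * n)))

      code : Fin (suc (m * n)) → Fin (m * n)
      code t = combine (state (toℕ t)) (path (toℕ t))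

      from-repeat : (∃₂ λ i j → i F.< j × code i ≡ code j) → InfinitePath
      from-repeat (i , j , i<j , eq) = periodic i<j (FP.toℕ≤pred[n] j) (proj₁ same) (proj₂ same)
        where
          same : state (toℕ i) ≡ state (toℕ j) × path (toℕ i) ≡ path (toℕ j)
          same = FP.combine-injective (state (toℕ i)) (path (toℕ i)) (state (toℕ j)) (path (toℕ j)) eq

module _ {σ n} (G : Graph σ n) where
  open Graph G

  occurrence-head : ∀ {v α} → Occurrence G v α → α 0 ≡ label v
  occurrence-head (us , us₀ , _ , us-label) = trans (sym (us-label 0)) (cong label us₀)

  occurrence-∷ : ∀ {u v α} → E u v ≡ true → Occurrence G u α → Occurrence G v (label v ∷ₛ α)
  occurrence-∷ {v = v} {α} e (us , us₀ , us-edge , us-label) = (v ∷ₛ us) , refl , edge , label-∷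
    where
      edge : ∀ i → E ((v ∷ₛ us) (suc i)) ((v ∷ₛ us) i) ≡ true
      edge zero    = subst (λ x → E x v ≡ true) (sym us₀) e
      edge (suc i) = us-edge i

      label-∷ : ∀ i → label ((v ∷ₛ us) i) ≡ (label v ∷ₛ α) i
      label-∷ zero    = refl
      label-∷ (suc i) = us-label i

  occurrence-exists : ∀ u → ∃ (Occurrence G u)
  occurrence-exists u = (label ∘ walk) , walk , refl , (λ i → proj₂ (incoming (walk i))) , λ _ → refl
    where
      walk : ℕ → Fin n
      walk zero    = u
      walk (suc i) = proj₁ (incoming (walk i))

  HasEdgeInto : SubsetCode n → Fin n → Set
  HasEdgeInto c x = ∃ λ y → y ∈ᶜ c × E x y ≡ true

  hasEdgeInto? : ∀ c → Decidable (HasEdgeInto c)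
  hasEdgeInto? c x = FP.any? λ y → (y ∈ᶜ? c) ×-dec (E x y BoolP.≟ true)

  MinimalPredecessor : SubsetCode n → Fin n → Set
  MinimalPredecessor c x = HasEdgeInto c x × (∀ y → HasEdgeInto c y → label x F.≤ label y)

  minimalPredecessor? : ∀ c → Decidable (MinimalPredecessor c)
  minimalPredecessor? c x =
    hasEdgeInto? c x ×-dec FP.all? (λ y → hasEdgeInto? c y →-dec (label x FP.≤? label y))

  nextFrontier : SubsetCode n → SubsetCode n
  nextFrontier c = ⟦ minimalPredecessor? c ⟧

  edgeInto : SubsetCode n → Fin n → Fin n
  edgeInto c x with hasEdgeInto? c x
  ... | yes (y , _) = y
  ... | no _        = x

  edgeInto-spec : ∀ {c x} → x ∈ᶜ nextFrontier c → edgeInto c x ∈ᶜ c × E x (edgeInto c x) ≡ true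
  edgeInto-spec {c} {x} x∈ with hasEdgeInto? c x
  ... | yes (y , y∈ , e) = y∈ , e
  ... | no ¬pre          = contradiction (proj₁ (∈⟦⟧⁻ (minimalPredecessor? c) x∈)) ¬pre

  module MinimalString (v : Fin n) where

    open InfiniteDescent nextFrontier (λ c x → x ∈ᶜ c) (λ x y → E x y ≡ true)
                         edgeInto edgeInto-spec ⟦ FP._≟ v ⟧
      renaming (state to frontier)

    frontier-nonempty : ∀ k → ∃ (_∈ᶜ frontier k)
    frontier-nonempty zero = v , ∈⟦⟧⁺ (FP._≟ v) refl
    frontier-nonempty (suc k) with frontier-nonempty k
    ... | x , x∈ with incoming x
    ...   | y , e with ∃-argmin label (hasEdgeInto? (frontier k)) (x , x∈ , e)
    ...     | z , z-pre , z-min =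
      z , ∈⟦⟧⁺ (minimalPredecessor? (frontier k)) (z-pre , z-min)

    frontier-path : InfinitePath
    frontier-path = infinite-descent frontier-nonempty

    minPath : ℕ → Fin n
    minPath = proj₁ frontier-path

    minPath-mem : ∀ k → minPath k ∈ᶜ frontier k
    minPath-mem k = proj₁ (proj₂ frontier-path k)

    minPath₀ : minPath 0 ≡ v
    minPath₀ = ∈⟦⟧⁻ (FP._≟ v) (minPath-mem 0)

    minString : Str σ
    minString k = label (minPath k)

    minPath-minimal : ∀ k → MinimalPredecessor (frontier k) (minPath (suc k))
    minPath-minimal k = ∈⟦⟧⁻ (minimalPredecessor? (frontier k)) (minPath-mem (suc k))

    minString-≤ : ∀ {k x y} → y ∈ᶜ frontier k → E x y ≡ true → minString (suc k) F.≤ label x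
    minString-≤ {k} y∈ e = proj₂ (minPath-minimal k) _ (_ , y∈ , e)

    frontier-closed : ∀ {k x y} → y ∈ᶜ frontier k → E x y ≡ true →
                      label x ≡ minString (suc k) → x ∈ᶜ frontier (suc k)
    frontier-closed {k} {x} y∈ e x-min =
      ∈⟦⟧⁺ (minimalPredecessor? (frontier k)) ((_ , y∈ , e) , x-minimal)
      where
        x-minimal : ∀ z → HasEdgeInto (frontier k) z → label x F.≤ label z
        x-minimal z z-pre = subst (F._≤ label z) (sym x-min) (proj₂ (minPath-minimal k) z z-pre)

    minString-occurrence : Occurrence G v minString
    minString-occurrence = minPath , minPath₀ , (λ k → proj₂ (proj₂ frontier-path k)) , λ _ → refl

    minString-minimal : ∀ β → Occurrence G v β → ¬ (β ≺ₛ minString)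
    minString-minimal β (ws , ws₀ , ws-edge , ws-label) (k , agree , β<min) =
      below k β<min ws-in-frontier
      where
        ws-in-frontier : ∀ i → i ℕ.< k → ws i ∈ᶜ frontier i
        ws-in-frontier zero    _     = subst (_∈ᶜ frontier 0) (sym ws₀) (∈⟦⟧⁺ (FP._≟ v) refl)
        ws-in-frontier (suc i) i+1<k =
          frontier-closed {i} (ws-in-frontier i (ℕP.<-trans (ℕP.n<1+n i) i+1<k)) (ws-edge i)
            (trans (ws-label (suc i)) (agree (suc i) i+1<k))

        below : ∀ j → β j ≺ₗ minString j → (∀ i → i ℕ.< j → ws i ∈ᶜ frontier i) → ⊥
        below zero β₀<min₀ _ =
          FP.<-irrefl (trans (sym (ws-label 0)) (cong label (trans ws₀ (sym minPath₀)))) β₀<min₀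
        below (suc j) β<min in-frontier = ℕP.<⇒≱ β<min min≤β
          where
            min≤β : minString (suc j) F.≤ β (suc j)
            min≤β = subst (minString (suc j) F.≤_) (ws-label (suc j))
                      (minString-≤ {j} (in-frontier j ℕP.≤-refl) (ws-edge j))

  IsMin-exists : ∀ v → Σ (Str σ) (IsMin G v)
  IsMin-exists v = minString , minString-occurrence , minString-minimal
    where open MinimalString v

  IsMin-second-≤ : ∀ {u v α} → IsMin G v α → E u v ≡ true → α 1 F.≤ label u
  IsMin-second-≤ {u} {v} {α} (α-occ , α-min) e with occurrence-exists u
  ... | γ , γ-occ = ℕP.≮⇒≥ λ u<α₁ →
    α-min (label v ∷ₛ γ) (occurrence-∷ e γ-occ)
      ( 1
      , (λ { zero _ → sym (occurrence-head α-occ) ; (suc _) (s≤s ()) })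
      , subst (F._< α 1) (sym (occurrence-head γ-occ)) u<α₁ )

lemma6 : ∀ {σ n} (G : Graph σ n) (u v : Fin n) →
    ((Graph.E G u v ≡ true → Graph.label G u ≺ₗ Graph.label G v → τNode G v 1)
    × (Graph.E G u v ≡ true → Graph.label G u ≡ Graph.label G v → τNode G u 1 → τNode G v 1))
lemma6 G u v with IsMin-exists G v
... | α , α-min@(α-occ , α-minimal) = smaller-label , equal-label
  where
    open Graph G

    α₀ : α 0 ≡ label v
    α₀ = occurrence-head G α-occ

    smaller-label : E u v ≡ true → label u ≺ₗ label v → τNode G v 1
    smaller-label e u<v = α , α-min , τ1 (0 , (λ _ ()) , α₁<α₀)
      where
        α₁<α₀ : α 1 F.< α 0
        α₁<α₀ = ℕP.≤-<-trans (IsMin-second-≤ G α-min e) (subst (label u F.<_) (sym α₀) u<v)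

    equal-label : E u v ≡ true → label u ≡ label v → τNode G u 1 → τNode G v 1
    equal-label e u≡v (αᵤ , (αᵤ-occ , _) , τ1 αᵤ-tail≺) =
      α , α-min , τ1 (tail≺const⇒tail≺ α₀′ (≺const⇒tail≺const α₀′ α≺a^ω))
      where
        αᵤ₀ : αᵤ 0 ≡ label u
        αᵤ₀ = occurrence-head G αᵤ-occ

        α₀′ : α 0 ≡ label u
        α₀′ = trans α₀ (sym u≡v)

        αᵤ≺a^ω : αᵤ ≺ₛ const (label u)
        αᵤ≺a^ω = tail≺const⇒≺const αᵤ₀ (tail≺⇒tail≺const αᵤ₀ αᵤ-tail≺)

        a·αᵤ≺a^ω : (label v ∷ₛ αᵤ) ≺ₛ const (label u)
        a·αᵤ≺a^ω = tail≺const⇒≺const (sym u≡v) αᵤ≺a^ω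

        α≺a^ω : α ≺ₛ const (label u)
        α≺a^ω = ≮ₛ-≺ₛ-trans (α-minimal _ (occurrence-∷ G e αᵤ-occ)) a·αᵤ≺a^ω
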